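{- Let $\Theta$ be a branch of a tableau of $\mathbf{TAB}_{\mathbf{IB}}$, let $N^\Theta$ be the set of nominals occurring in $\Theta$, and let $G=(N^\Theta,\prec_\Theta)$. Then $G$ is a finite set of well-founded, finitely branching trees (i.e. a finite disjoint union of trees, with edges given by $\prec_\Theta$, each of which is well-founded and in which every node has finitely many $\prec_\Theta$-successors).
   Context: Hybrid language: fix disjoint countably infinite sets $\mathbf{Prop}$ (propositional variables) and $\mathbf{Nom}$ (nominals). Formulas: $\varphi ::= p \mid i \mid \neg\varphi \mid \varphi\land\varphi \mid \diamondsuit\varphi \mid @_i\varphi$ with $p\in\mathbf{Prop}$, $i\in\mathbf{Nom}$; $\square\varphi$ abbreviates $\neg\diamondsuit\neg\varphi$. Tableaux of $\mathbf{TAB}_{\mathbf{IB}}$: a tableau is a well-founded tree of formulas of the form $@_i\varphi$, started from a root formula $@_i\varphi$ where $i$ does not occur in $\varphi$. Each branch (maximal path) is extended by applying the rules below as often as possible, except that nothing more is added to a branch once it is closed, or once every formula that any rule could generate already occurs on it. A branch $\Theta$ is closed if $@_i\varphi, @_i\neg\varphi\in\Theta$ for some $i,\varphi$. Rules (premises already on the branch, conclusions added to it): [$\neg\neg$] from $@_i\neg\neg\varphi$ add $@_i\varphi$; [$\land$] from $@_i(\varphi\land\psi)$ add $@_i\varphi$ and $@_i\psi$; [$\neg\land$] from $@_i\neg(\varphi\land\psi)$ split the branch into one branch with $@_i\neg\varphi$ and one with $@_i\neg\psi$; [$\diamondsuit$] from $@_i\diamondsuit\varphi$ add $@_i\diamondsuit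 j$ and $@_j\varphi$, where $j$ is a nominal not yet occurring on the branch, the rule is applied at most once per formula, the premise is not an accessibility formula, and (restriction $\mathcal{D}$) $i$ is a quasi-urfather on the branch; [$\neg\diamondsuit$] from $@_i\neg\diamondsuit\varphi$ and $@_i\diamondsuit j$ add $@_j\neg\varphi$; [$@$] from $@_i@_j\varphi$ add $@_j\varphi$; [$\neg@$] from $@_i\neg@_j\varphi$ add $@_j\neg\varphi$; [$\mathit{Id}$] from $@_i\varphi$ and $@_i j$ add $@_j\varphi$, provided $@_i\varphi$ is not an accessibility formula; [$\mathit{Ref}$] add $@_i i$ for any nominal $i$ occurring on the branch; [$\square_{\mathit{sym}}$] from $@_i\square\varphi$ and $@_j\diamondsuit i$ add $@_j\varphi$; ($\mathcal{I}$) for every nominal $i$ occurring on the branch add $@_i\neg\diamondsuit i$. An accessibility formula is a formula $@_i\diamondsuit j$ added by [$\diamondsuit$] with $j$ new. Auxiliary notions for a branch $\Theta$: $@_i\varphi$ is a quasi-subformula of $@_j\psi$ if $\varphi$ is a subformula of $\psi$, or $\varphi=\neg\chi$ with $\chi$ a subformula of $\psi$. $T^\Theta(i)=\{\varphi \mid @_i\varphi\in\Theta$ and $@_i\varphi$ is a quasi-subformula of the root formula$\}$. Nominals $i,j$ are twins in $\Theta$ if $T^\Theta(i)=T^\Theta(j)$. $i\prec_\Theta j$ if $j$ was introduced by applying [$\diamondsuit$] to a formula $@_i\diamondsuit\varphi$ (equivalently, $@_i\diamondsuit j$ is an accessibility formula in $\Theta$); $\prec_\Theta^*$ is its reflexive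 transitive closure. A nominal $i$ is a quasi-urfather on $\Theta$ if there are no twins $j\neq k$ with $j\prec_\Theta^* i$ and $k\prec_\Theta^* i$. -}

module Defs where

open import Data.Nat using (ℕ; zero; suc; _≤_)
open import Data.List using (List; []; _∷_; _++_; length; concatMap)
open import Data.List.Membership.Propositional using (_∈_; _∉_)
open import Data.List.Relation.Unary.All using (All)
open import Data.List.Relation.Unary.Unique.Propositional using (Unique)
open import Data.Maybe using (Maybe; just; nothing)
open import Data.Product using (Σ; ∃; ∃-syntax; _×_; _,_; proj₁; proj₂)
open import Data.Sum using (_⊎_)
open import Data.Unit using (⊤)
open import Relation.Nullary using (¬_)
open import Relation.Binary.PropositionalEquality using (_≡_; _≢_)
open import Relation.Binary.Construct.Closure.ReflexiveTransitive using (Star)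
open import Induction.WellFounded using (WellFounded)

-- Nominals and propositional variables: two disjoint countably infinite
-- sorts (disjointness is by the separate constructors of Form).
Nom : Set
Nom = ℕ

PropVar : Set
PropVar = ℕ

data Form : Set where
  prop : PropVar → Form
  nom  : Nom → Form
  neg  : Form → Form
  and  : Form → Form → Form
  dia  : Form → Form
  at   : Nom → Form → Form

box : Form → Form
box φ = neg (dia (neg φ))

-- Formulas on a branch all have the form @_i φ; we store them as pairs (i , φ).
SF : Set
SF = Nom × Form

data _⊑_ : Form → Form → Set where
  ⊑-refl : ∀ {φ} → φ ⊑ φ
  ⊑-neg  : ∀ {φ ψ} → φ ⊑ ψ → φ ⊑ neg ψ
  ⊑-andˡ : ∀ {φ ψ χ} → φ ⊑ ψ → φ ⊑ and ψ χ
  ⊑-andʳ : ∀ {φ ψ χ} → φ ⊑ χ → φ ⊑ and ψ χ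
  ⊑-dia  : ∀ {φ ψ} → φ ⊑ ψ → φ ⊑ dia ψ
  ⊑-at   : ∀ {φ ψ i} → φ ⊑ ψ → φ ⊑ at i ψ

data NomIn (i : Nom) : Form → Set where
  in-nom  : NomIn i (nom i)
  in-neg  : ∀ {φ} → NomIn i φ → NomIn i (neg φ)
  in-andˡ : ∀ {φ ψ} → NomIn i φ → NomIn i (and φ ψ)
  in-andʳ : ∀ {φ ψ} → NomIn i ψ → NomIn i (and φ ψ)
  in-dia  : ∀ {φ} → NomIn i φ → NomIn i (dia φ)
  in-at₁  : ∀ {φ} → NomIn i (at i φ)
  in-at₂  : ∀ {j φ} → NomIn i φ → NomIn i (at j φ)

OccursSF : Nom → SF → Set
OccursSF i (j , φ) = i ≡ j ⊎ NomIn i φ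

data App : Set where
  r¬¬   : Nom → Form → App
  r∧    : Nom → Form → Form → App
  r¬∧₁  : Nom → Form → Form → App          -- i φ ψ : @_i¬(φ∧ψ) ⟹ @_i¬φ (left branch)
  r¬∧₂  : Nom → Form → Form → App          -- i φ ψ : @_i¬(φ∧ψ) ⟹ @_i¬ψ (right branch)
  r◇    : Nom → Form → Nom → App
  r¬◇   : Nom → Form → Nom → App
  r-at    : Nom → Nom → Form → App
  r¬at   : Nom → Nom → Form → App
  rId   : Nom → Nom → Form → App
  rRef  : Nom → App
  r□sym : Nom → Nom → Form → App
  rI    : Nom → App

premises : App → List SF
premises (r¬¬ i φ)      = (i , neg (neg φ)) ∷ []
premises (r∧ i φ ψ)     = (i , and φ ψ) ∷ []
premises (r¬∧₁ i φ ψ)   = (i , neg (and φ ψ)) ∷ []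
premises (r¬∧₂ i φ ψ)   = (i , neg (and φ ψ)) ∷ []
premises (r◇ i φ j)     = (i , dia φ) ∷ []
premises (r¬◇ i φ j)    = (i , neg (dia φ)) ∷ (i , dia (nom j)) ∷ []
premises (r-at i j φ)     = (i , at j φ) ∷ []
premises (r¬at i j φ)    = (i , neg (at j φ)) ∷ []
premises (rId i j φ)    = (i , φ) ∷ (i , nom j) ∷ []
premises (rRef i)       = []
premises (r□sym i j φ)  = (i , box φ) ∷ (j , dia (nom i)) ∷ []
premises (rI i)         = []

conclusions : App → List SF
conclusions (r¬¬ i φ)     = (i , φ) ∷ []
conclusions (r∧ i φ ψ)    = (i , φ) ∷ (i , ψ) ∷ []
conclusions (r¬∧₁ i φ ψ)  = (i , neg φ) ∷ []
conclusions (r¬∧₂ i φ ψ)  = (i , neg ψ) ∷ []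
conclusions (r◇ i φ j)    = (i , dia (nom j)) ∷ (j , φ) ∷ []
conclusions (r¬◇ i φ j)   = (j , neg φ) ∷ []
conclusions (r-at i j φ)    = (j , φ) ∷ []
conclusions (r¬at i j φ)   = (j , neg φ) ∷ []
conclusions (rId i j φ)   = (j , φ) ∷ []
conclusions (rRef i)      = (i , nom i) ∷ []
conclusions (r□sym i j φ) = (j , φ) ∷ []
conclusions (rI i)        = (i , neg (dia (nom i))) ∷ []

-- A (partial) branch: a root formula plus the list of rule applications
-- performed so far, in chronological order.

Forms : SF → List App → List SF
Forms root h = root ∷ concatMap conclusions h

accOf : App → List SF
accOf (r◇ i φ j) = (i , dia (nom j)) ∷ []
accOf _          = []

AccForms : List App → List SF
AccForms h = concatMap accOf h

OccursOn : SF → List App → Nom → Set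
OccursOn root h i = ∃[ x ] (x ∈ Forms root h × OccursSF i x)

Prec : List App → Nom → Nom → Set
Prec h i j = ∃[ φ ] (r◇ i φ j ∈ h)

QSub : Form → SF → Set
QSub φ (r , ψ) = φ ⊑ ψ ⊎ ∃[ χ ] (φ ≡ neg χ × χ ⊑ ψ)

InT : SF → List App → Nom → Form → Set
InT root h i φ = (i , φ) ∈ Forms root h × QSub φ root

Twins : SF → List App → Nom → Nom → Set
Twins root h i j = ∀ φ → (InT root h i φ → InT root h j φ) × (InT root h j φ → InT root h i φ)

QuasiUrfather : SF → List App → Nom → Set
QuasiUrfather root h i =
  ¬ (∃[ j ] ∃[ k ] (j ≢ k × Twins root h j k × Star (Prec h) j i × Star (Prec h) k i))

Side : SF → List App → App → Set
Side root h (r◇ i φ j)   =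
  ¬ OccursOn root h j
  × ¬ (∃[ k ] (r◇ i φ k ∈ h))
  × (i , dia φ) ∉ AccForms h
  × QuasiUrfather root h i
Side root h (rId i j φ)  = (i , φ) ∉ AccForms h
Side root h (rRef i)     = OccursOn root h i
Side root h (rI i)       = OccursOn root h i
Side root h _            = ⊤

Applicable : SF → List App → App → Set
Applicable root h a = All (_∈ Forms root h) (premises a) × Side root h a

Closed : SF → List App → Set
Closed root h = ∃[ i ] ∃[ φ ] ((i , φ) ∈ Forms root h × (i , neg φ) ∈ Forms root h)

Saturated : SF → List App → Set
Saturated root h = ∀ a → Applicable root h a → All (_∈ Forms root h) (conclusions a)

LegalStep : SF → List App → App → Set
LegalStep root h a = ¬ Closed root h × ¬ Saturated root h × Applicable root h a

-- Branches of TAB_IB tableaux, possibly infinite: step n is the n-th rule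
-- application on the branch (nothing = the branch has already ended).

toList : Maybe App → List App
toList nothing  = []
toList (just a) = a ∷ []

history : (ℕ → Maybe App) → ℕ → List App
history s zero    = []
history s (suc n) = history s n ++ toList (s n)

record Branch : Set where
  field
    root      : SF
    rootFresh : ¬ NomIn (proj₁ root) (proj₂ root)
    step      : ℕ → Maybe App
    ended     : ∀ n → step n ≡ nothing → step (suc n) ≡ nothing
    legal     : ∀ n a → step n ≡ just a → LegalStep root (history step n) a
    maximal   : ∀ n → step n ≡ nothing →
                Closed root (history step n) ⊎ Saturated root (history step n)

module _ (Θ : Branch) where
  open Branch Θ

  InΘ : SF → Set
  InΘ x = ∃[ n ] (x ∈ Forms root (history step n))

  NomΘ : Nom → Set
  NomΘ i = ∃[ x ] (InΘ x × OccursSF i x)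

  PrecΘ : Nom → Nom → Set
  PrecΘ i j = ∃[ n ] ∃[ φ ] (step n ≡ just (r◇ i φ j))

record FiniteForestWFFB (N : Nom → Set) (_≺_ : Nom → Nom → Set) : Set where
  field
    edges         : ∀ i j → i ≺ j → N i × N j
    uniqueParent  : ∀ i j k → i ≺ k → j ≺ k → i ≡ j
    wellFounded   : WellFounded _≺_
    -- finitely many trees: a finite list of roots (parentless nodes of N)
    -- such that every node of N lies in the tree of one of them
    roots         : List Nom
    rootsAreRoots : All (λ r → N r × ¬ (∃[ p ] (p ≺ r))) roots
    covered       : ∀ i → N i → ∃[ r ] (r ∈ roots × Star _≺_ r i)
    finBranching  : ∀ i → N i → ∃[ b ] (∀ (L : List Nom) → Unique L → All (i ≺_) L → length L ≤ b)

-- Every nominal not occurring in the root formula is created exactly once,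
-- fresh, by a [◇] step whose premise already mentions its parent.  Hence
-- parents are unique, a child first appears strictly later than its parent
-- (which gives well-foundedness), and every nominal on the branch is reached
-- from a nominal of the root formula.  For finite branching, an induction
-- along the branch shows that every formula on it that is not an
-- accessibility formula is a quasi-subformula of the root formula or has one
-- of the shapes @_i j, @_i¬◇j, @_i¬j.  So the premise @_i◇φ of each [◇]
-- step has φ a subformula of the root formula, and since [◇] is applied at
-- most once per formula, these φ label the children of i injectively.

module Submission where

open import Defs
open import Data.Nat using (ℕ; zero; suc; _≤_; _<_; _≤′_; ≤′-refl; ≤′-step; z≤n; s≤s)
open import Data.Nat.Properties using (≤-antisym; ≮⇒≥; ≰⇒>; n≤1+n; ≤⇒≤′)
open import Data.Nat.Induction using (<-wellFounded)
open import Data.List using (List; []; _∷_; [_]; _++_; length)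
open import Data.List.Properties using (length-++-sucʳ)
open import Data.List.Membership.Propositional using (_∈_; _∉_; lose; find)
open import Data.List.Membership.Propositional.Properties using (∈-++⁺ˡ; ∈-++⁺ʳ; ∈-++⁻; ∈-∃++)
open import Data.List.Relation.Binary.Subset.Propositional using (_⊆_)
open import Data.List.Relation.Binary.Subset.Propositional.Properties
  using (⊆-refl; ⊆-trans; xs⊆xs++ys; ∷⁺ʳ; concatMap⁺)
open import Data.List.Relation.Unary.Any using (Any; here; there)
import Data.List.Relation.Unary.Any.Properties as Any
open import Data.List.Relation.Unary.All using (All; []; _∷_)
import Data.List.Relation.Unary.All as All
open import Data.List.Relation.Unary.AllPairs using ([]; _∷_)
open import Data.List.Relation.Unary.Unique.Propositional using (Unique)
open import Data.Maybe using (just)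
open import Data.Maybe.Properties using (just-injective)
open import Data.Product using (∃-syntax; ∃₂; _×_; _,_; proj₁; proj₂)
open import Data.Sum using (_⊎_; inj₁; inj₂)
open import Data.Empty using (⊥-elim)
open import Function using (_∘_)
open import Relation.Nullary using (¬_)
open import Relation.Binary.PropositionalEquality using (_≡_; _≢_; refl; sym; trans; subst)
open import Relation.Binary.Construct.Closure.ReflexiveTransitive using (Star; ε; _◅_; _◅◅_)
open import Induction.WellFounded using (WellFounded; Acc; acc)

∈-delete : ∀ {A : Set} (xs : List A) {x y ys} → y ∈ xs ++ x ∷ ys → y ≢ x → y ∈ xs ++ ys
∈-delete []       (here refl) y≢x = ⊥-elim (y≢x refl)
∈-delete []       (there y∈)  _   = y∈
∈-delete (_ ∷ xs) (here refl) _   = here refl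
∈-delete (_ ∷ xs) (there y∈)  y≢x = there (∈-delete xs y∈ y≢x)

injective⇒length≤ : ∀ {A B : Set} {R : A → B → Set} {as : List A} {bs : List B} →
                    (∀ {a a′ b} → R a b → R a′ b → a ≡ a′) → Unique as →
                    All (λ a → ∃[ b ] (b ∈ bs × R a b)) as → length as ≤ length bs
injective⇒length≤ inj [] [] = z≤n
injective⇒length≤ {R = R} inj (a∉as ∷ as!) ((b , b∈bs , aRb) ∷ ws)
  with bs₁ , bs₂ , refl ← ∈-∃++ b∈bs =
  subst (_ ≤_) (sym (length-++-sucʳ bs₁ b bs₂))
        (s≤s (injective⇒length≤ inj as! (All.zipWith avoid-b (a∉as , ws))))
  where
  avoid-b : ∀ {a′} → _ ≢ a′ × ∃[ b′ ] (b′ ∈ bs₁ ++ b ∷ bs₂ × R a′ b′) →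
            ∃[ b′ ] (b′ ∈ bs₁ ++ bs₂ × R a′ b′)
  avoid-b (a≢a′ , b′ , b′∈ , a′Rb′) =
    b′ , ∈-delete bs₁ b′∈ (λ { refl → a≢a′ (inj aRb a′Rb′) }) , a′Rb′

⊑-trans : ∀ {φ ψ χ} → φ ⊑ ψ → ψ ⊑ χ → φ ⊑ χ
⊑-trans p ⊑-refl     = p
⊑-trans p (⊑-neg q)  = ⊑-neg (⊑-trans p q)
⊑-trans p (⊑-andˡ q) = ⊑-andˡ (⊑-trans p q)
⊑-trans p (⊑-andʳ q) = ⊑-andʳ (⊑-trans p q)
⊑-trans p (⊑-dia q)  = ⊑-dia (⊑-trans p q)
⊑-trans p (⊑-at q)   = ⊑-at (⊑-trans p q)

⊑-neg⁻ : ∀ {φ ψ} → neg φ ⊑ ψ → φ ⊑ ψ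
⊑-neg⁻ = ⊑-trans (⊑-neg ⊑-refl)

⊑-andˡ⁻ : ∀ {φ χ ψ} → and φ χ ⊑ ψ → φ ⊑ ψ
⊑-andˡ⁻ = ⊑-trans (⊑-andˡ ⊑-refl)

⊑-andʳ⁻ : ∀ {φ χ ψ} → and φ χ ⊑ ψ → χ ⊑ ψ
⊑-andʳ⁻ = ⊑-trans (⊑-andʳ ⊑-refl)

⊑-dia⁻ : ∀ {φ ψ} → dia φ ⊑ ψ → φ ⊑ ψ
⊑-dia⁻ = ⊑-trans (⊑-dia ⊑-refl)

⊑-at⁻ : ∀ {i φ ψ} → at i φ ⊑ ψ → φ ⊑ ψ
⊑-at⁻ = ⊑-trans (⊑-at ⊑-refl)

subformulas        : Form → List Form
proper-subformulas : Form → List Form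

subformulas φ = φ ∷ proper-subformulas φ

proper-subformulas (prop _)  = []
proper-subformulas (nom _)   = []
proper-subformulas (neg φ)   = subformulas φ
proper-subformulas (and φ ψ) = subformulas φ ++ subformulas ψ
proper-subformulas (dia φ)   = subformulas φ
proper-subformulas (at _ φ)  = subformulas φ

⊑⇒∈subformulas : ∀ {φ ψ} → φ ⊑ ψ → φ ∈ subformulas ψ
⊑⇒∈subformulas ⊑-refl                = here refl
⊑⇒∈subformulas (⊑-neg p)             = there (⊑⇒∈subformulas p)
⊑⇒∈subformulas (⊑-andˡ p)            = there (∈-++⁺ˡ (⊑⇒∈subformulas p))
⊑⇒∈subformulas (⊑-andʳ {ψ = ψ} p)    = there (∈-++⁺ʳ (subformulas ψ) (⊑⇒∈subformulas p))
⊑⇒∈subformulas (⊑-dia p)             = there (⊑⇒∈subformulas p)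
⊑⇒∈subformulas (⊑-at p)              = there (⊑⇒∈subformulas p)

nominals : Form → List Nom
nominals (prop _)  = []
nominals (nom i)   = [ i ]
nominals (neg φ)   = nominals φ
nominals (and φ ψ) = nominals φ ++ nominals ψ
nominals (dia φ)   = nominals φ
nominals (at i φ)  = i ∷ nominals φ

NomIn⇒∈nominals : ∀ {i φ} → NomIn i φ → i ∈ nominals φ
NomIn⇒∈nominals in-nom                = here refl
NomIn⇒∈nominals (in-neg p)            = NomIn⇒∈nominals p
NomIn⇒∈nominals (in-andˡ p)           = ∈-++⁺ˡ (NomIn⇒∈nominals p)
NomIn⇒∈nominals (in-andʳ {φ = φ} p)   = ∈-++⁺ʳ (nominals φ) (NomIn⇒∈nominals p)
NomIn⇒∈nominals (in-dia p)            = NomIn⇒∈nominals p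
NomIn⇒∈nominals in-at₁                = here refl
NomIn⇒∈nominals (in-at₂ p)            = there (NomIn⇒∈nominals p)

∈nominals⇒NomIn : ∀ {i} φ → i ∈ nominals φ → NomIn i φ
∈nominals⇒NomIn (nom i)   (here refl) = in-nom
∈nominals⇒NomIn (neg φ)   p           = in-neg (∈nominals⇒NomIn φ p)
∈nominals⇒NomIn (and φ ψ) p with ∈-++⁻ (nominals φ) p
... | inj₁ q = in-andˡ (∈nominals⇒NomIn φ q)
... | inj₂ q = in-andʳ (∈nominals⇒NomIn ψ q)
∈nominals⇒NomIn (dia φ)   p           = in-dia (∈nominals⇒NomIn φ p)
∈nominals⇒NomIn (at i φ)  (here refl) = in-at₁
∈nominals⇒NomIn (at i φ)  (there p)   = in-at₂ (∈nominals⇒NomIn φ p)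

nominalsSF : SF → List Nom
nominalsSF (i , φ) = i ∷ nominals φ

OccursSF⇒∈nominalsSF : ∀ {i} x → OccursSF i x → i ∈ nominalsSF x
OccursSF⇒∈nominalsSF _ (inj₁ refl) = here refl
OccursSF⇒∈nominalsSF _ (inj₂ p)    = there (NomIn⇒∈nominals p)

∈nominalsSF⇒OccursSF : ∀ {i} x → i ∈ nominalsSF x → OccursSF i x
∈nominalsSF⇒OccursSF _       (here refl) = inj₁ refl
∈nominalsSF⇒OccursSF (_ , φ) (there p)   = inj₂ (∈nominals⇒NomIn φ p)

-- The quasi-subformulas of ψ, together with the formulas created out of
-- nothing by [Ref] and (I), and by [¬◇] applied to a formula from (I).
data Tame (ψ : Form) : Form → Set where
  sub         : ∀ {φ} → φ ⊑ ψ → Tame ψ φ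
  neg-sub     : ∀ {φ} → φ ⊑ ψ → Tame ψ (neg φ)
  nom         : ∀ {j} → Tame ψ (nom j)
  neg-dia-nom : ∀ {j} → Tame ψ (neg (dia (nom j)))
  neg-nom     : ∀ {j} → Tame ψ (neg (nom j))

TameOn : SF → List App → Set
TameOn root h = ∀ {x} → x ∈ Forms root h → x ∉ AccForms h → Tame (proj₂ root) (proj₂ x)

∈-Forms⁺ : ∀ {root h a x} → a ∈ h → x ∈ conclusions a → x ∈ Forms root h
∈-Forms⁺ a∈h x∈a = there (Any.concatMap⁺ conclusions (lose a∈h x∈a))

∈-AccForms⁺ : ∀ {h a x} → a ∈ h → x ∈ accOf a → x ∈ AccForms h
∈-AccForms⁺ a∈h x∈a = Any.concatMap⁺ accOf (lose a∈h x∈a)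

AccForms-mono : ∀ {h h′} → h ⊆ h′ → AccForms h ⊆ AccForms h′
AccForms-mono = concatMap⁺ accOf

accOf-shape : ∀ a {i φ} → (i , φ) ∈ accOf a → ∃[ j ] (φ ≡ dia (nom j))
accOf-shape (r◇ _ _ j) (here refl) = j , refl

non-dia-nom∉AccForms : ∀ {h i φ} → (∀ {j} → φ ≢ dia (nom j)) → (i , φ) ∉ AccForms h
non-dia-nom∉AccForms {h} φ≢◇j x∈ with find (Any.concatMap⁻ accOf {xs = h} x∈)
... | a , _ , x∈a = φ≢◇j (proj₂ (accOf-shape a x∈a))

Introduces : App → Nom → Set
Introduces a j = ∃₂ λ i φ → a ≡ r◇ i φ j

module _ {root : SF} {h : List App} where

  private
    on-branch : ∀ {x j} {B : Set} → x ∈ Forms root h → OccursSF j x → OccursOn root h j ⊎ B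
    on-branch p o = inj₁ (_ , p , o)

    principal : ∀ {i φ} → TameOn root h → (i , φ) ∈ Forms root h →
                (∀ {j} → φ ≢ dia (nom j)) → Tame (proj₂ root) φ
    principal tame p φ≢◇j = tame p (non-dia-nom∉AccForms {h} φ≢◇j)

  conclusions-tame : TameOn root h → ∀ a → Applicable root h a →
                     All (λ x → x ∈ accOf a ⊎ Tame (proj₂ root) (proj₂ x)) (conclusions a)
  conclusions-tame tame (r¬¬ i φ) (p ∷ [] , _) with principal tame p (λ ())
  ... | sub q     = inj₂ (sub (⊑-neg⁻ (⊑-neg⁻ q))) ∷ []
  ... | neg-sub q = inj₂ (sub (⊑-neg⁻ q)) ∷ []
  conclusions-tame tame (r∧ i φ ψ) (p ∷ [] , _) with principal tame p (λ ())
  ... | sub q = inj₂ (sub (⊑-andˡ⁻ q)) ∷ inj₂ (sub (⊑-andʳ⁻ q)) ∷ []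
  conclusions-tame tame (r¬∧₁ i φ ψ) (p ∷ [] , _) with principal tame p (λ ())
  ... | sub q     = inj₂ (neg-sub (⊑-andˡ⁻ (⊑-neg⁻ q))) ∷ []
  ... | neg-sub q = inj₂ (neg-sub (⊑-andˡ⁻ q)) ∷ []
  conclusions-tame tame (r¬∧₂ i φ ψ) (p ∷ [] , _) with principal tame p (λ ())
  ... | sub q     = inj₂ (neg-sub (⊑-andʳ⁻ (⊑-neg⁻ q))) ∷ []
  ... | neg-sub q = inj₂ (neg-sub (⊑-andʳ⁻ q)) ∷ []
  conclusions-tame tame (r◇ i φ j) (p ∷ [] , _ , _ , not-acc , _) with tame p not-acc
  ... | sub q = inj₁ (here refl) ∷ inj₂ (sub (⊑-dia⁻ q)) ∷ []
  conclusions-tame tame (r¬◇ i φ j) (p ∷ _ , _) with principal tame p (λ ())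
  ... | sub q       = inj₂ (neg-sub (⊑-dia⁻ (⊑-neg⁻ q))) ∷ []
  ... | neg-sub q   = inj₂ (neg-sub (⊑-dia⁻ q)) ∷ []
  ... | neg-dia-nom = inj₂ neg-nom ∷ []
  conclusions-tame tame (r-at i j φ) (p ∷ [] , _) with principal tame p (λ ())
  ... | sub q = inj₂ (sub (⊑-at⁻ q)) ∷ []
  conclusions-tame tame (r¬at i j φ) (p ∷ [] , _) with principal tame p (λ ())
  ... | sub q     = inj₂ (neg-sub (⊑-at⁻ (⊑-neg⁻ q))) ∷ []
  ... | neg-sub q = inj₂ (neg-sub (⊑-at⁻ q)) ∷ []
  conclusions-tame tame (rId i j φ) (p ∷ _ , not-acc) = inj₂ (tame p not-acc) ∷ []
  conclusions-tame tame (rRef i) _ = inj₂ nom ∷ []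
  conclusions-tame tame (r□sym i j φ) (p ∷ _ , _) with principal tame p (λ ())
  ... | sub q     = inj₂ (sub (⊑-neg⁻ (⊑-dia⁻ (⊑-neg⁻ q)))) ∷ []
  ... | neg-sub q = inj₂ (sub (⊑-neg⁻ (⊑-dia⁻ q))) ∷ []
  conclusions-tame tame (rI i) _ = inj₂ neg-dia-nom ∷ []

  conclusions-nominals : ∀ a → Applicable root h a →
                         All (λ x → ∀ {j} → OccursSF j x → OccursOn root h j ⊎ Introduces a j)
                             (conclusions a)
  conclusions-nominals (r¬¬ i φ) (p ∷ [] , _) =
    (λ { (inj₁ e) → on-branch p (inj₁ e) ; (inj₂ q) → on-branch p (inj₂ (in-neg (in-neg q))) }) ∷ []
  conclusions-nominals (r∧ i φ ψ) (p ∷ [] , _) =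
    (λ { (inj₁ e) → on-branch p (inj₁ e) ; (inj₂ q) → on-branch p (inj₂ (in-andˡ q)) }) ∷
    (λ { (inj₁ e) → on-branch p (inj₁ e) ; (inj₂ q) → on-branch p (inj₂ (in-andʳ q)) }) ∷ []
  conclusions-nominals (r¬∧₁ i φ ψ) (p ∷ [] , _) =
    (λ { (inj₁ e) → on-branch p (inj₁ e)
       ; (inj₂ (in-neg q)) → on-branch p (inj₂ (in-neg (in-andˡ q))) }) ∷ []
  conclusions-nominals (r¬∧₂ i φ ψ) (p ∷ [] , _) =
    (λ { (inj₁ e) → on-branch p (inj₁ e)
       ; (inj₂ (in-neg q)) → on-branch p (inj₂ (in-neg (in-andʳ q))) }) ∷ []
  conclusions-nominals (r◇ i φ j) (p ∷ [] , _) =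
    (λ { (inj₁ e) → on-branch p (inj₁ e) ; (inj₂ (in-dia in-nom)) → inj₂ (i , φ , refl) }) ∷
    (λ { (inj₁ refl) → inj₂ (i , φ , refl) ; (inj₂ q) → on-branch p (inj₂ (in-dia q)) }) ∷ []
  conclusions-nominals (r¬◇ i φ j) (p ∷ p′ ∷ [] , _) =
    (λ { (inj₁ refl) → on-branch p′ (inj₂ (in-dia in-nom))
       ; (inj₂ (in-neg q)) → on-branch p (inj₂ (in-neg (in-dia q))) }) ∷ []
  conclusions-nominals (r-at i j φ) (p ∷ [] , _) =
    (λ { (inj₁ refl) → on-branch p (inj₂ in-at₁) ; (inj₂ q) → on-branch p (inj₂ (in-at₂ q)) }) ∷ []
  conclusions-nominals (r¬at i j φ) (p ∷ [] , _) =
    (λ { (inj₁ refl) → on-branch p (inj₂ (in-neg in-at₁))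
       ; (inj₂ (in-neg q)) → on-branch p (inj₂ (in-neg (in-at₂ q))) }) ∷ []
  conclusions-nominals (rId i j φ) (p ∷ p′ ∷ [] , _) =
    (λ { (inj₁ refl) → on-branch p′ (inj₂ in-nom) ; (inj₂ q) → on-branch p (inj₂ q) }) ∷ []
  conclusions-nominals (rRef i) ([] , i-on) =
    (λ { (inj₁ refl) → inj₁ i-on ; (inj₂ in-nom) → inj₁ i-on }) ∷ []
  conclusions-nominals (r□sym i j φ) (p ∷ p′ ∷ [] , _) =
    (λ { (inj₁ refl) → on-branch p′ (inj₁ refl)
       ; (inj₂ q) → on-branch p (inj₂ (in-neg (in-dia (in-neg q)))) }) ∷ []
  conclusions-nominals (rI i) ([] , i-on) =
    (λ { (inj₁ refl) → inj₁ i-on ; (inj₂ (in-neg (in-dia in-nom))) → inj₁ i-on }) ∷ []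

module _ (Θ : Branch) where
  open Branch Θ

  private
    H : ℕ → List App
    H = history step

    _≺_ : Nom → Nom → Set
    _≺_ = PrecΘ Θ

  history-mono : ∀ {n m} → n ≤ m → H n ⊆ H m
  history-mono = go ∘ ≤⇒≤′
    where
    go : ∀ {n m} → n ≤′ m → H n ⊆ H m
    go ≤′-refl             = ⊆-refl
    go (≤′-step {m} n≤′m) = ⊆-trans (go n≤′m) (xs⊆xs++ys (H m) (toList (step m)))

  occurs-mono : ∀ {n m j} → n ≤ m → OccursOn root (H n) j → OccursOn root (H m) j
  occurs-mono n≤m (x , x∈ , o) = x , ∷⁺ʳ root (concatMap⁺ conclusions (history-mono n≤m)) x∈ , o

  step∈history : ∀ {n a} → step n ≡ just a → a ∈ H (suc n)
  step∈history {n} eq rewrite eq = ∈-++⁺ʳ (H n) (here refl)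

  applicable : ∀ {n a} → step n ≡ just a → Applicable root (H n) a
  applicable eq = proj₂ (proj₂ (legal _ _ eq))

  new-formula : ∀ {n x} → x ∈ Forms root (H (suc n)) →
                x ∈ Forms root (H n) ⊎ ∃[ a ] (step n ≡ just a × x ∈ conclusions a)
  new-formula (here refl) = inj₁ (here refl)
  new-formula {n} (there x∈) with Any.++⁻ (H n) (Any.concatMap⁻ conclusions x∈)
  ... | inj₁ old = inj₁ (there (Any.concatMap⁺ conclusions old))
  ... | inj₂ new with step n
  ...   | just a = inj₂ (a , refl , lookup-single new)
    where
    lookup-single : ∀ {P : App → Set} → Any P [ a ] → P a
    lookup-single (here p) = p

  branch-tame : ∀ n → TameOn root (H n)
  branch-tame zero    (here refl) _ = sub ⊑-refl
  branch-tame (suc n) x∈ x∉acc with new-formula {n} x∈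
  ... | inj₁ old = branch-tame n old (x∉acc ∘ AccForms-mono (history-mono (n≤1+n n)))
  ... | inj₂ (a , eq , x∈a) with All.lookup (conclusions-tame (branch-tame n) a (applicable eq)) x∈a
  ...   | inj₁ x∈acc = ⊥-elim (x∉acc (∈-AccForms⁺ (step∈history eq) x∈acc))
  ...   | inj₂ t   = t

  module _ {n i φ j} (eq : step n ≡ just (r◇ i φ j)) where
    private
      side : Side root (H n) (r◇ i φ j)
      side = proj₂ (applicable eq)

    ◇-premise : (i , dia φ) ∈ Forms root (H n)
    ◇-premise with proj₁ (applicable eq)
    ... | p ∷ [] = p

    child-fresh : ¬ OccursOn root (H n) j
    child-fresh = proj₁ side

    ◇-unused : ¬ (∃[ k ] (r◇ i φ k ∈ H n))
    ◇-unused = proj₁ (proj₂ side)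

    ◇-premise-sub : dia φ ⊑ proj₂ root
    ◇-premise-sub with branch-tame n ◇-premise (proj₁ (proj₂ (proj₂ side)))
    ... | sub q = q

    parent-occurs : OccursOn root (H n) i
    parent-occurs = _ , ◇-premise , inj₁ refl

    child-formula : (j , φ) ∈ Forms root (H (suc n))
    child-formula = ∈-Forms⁺ (step∈history eq) (there (here refl))

    child-occurs : OccursOn root (H (suc n)) j
    child-occurs = _ , child-formula , inj₁ refl

    introduced-before : ∀ {m} → OccursOn root (H m) j → n < m
    introduced-before o = ≰⇒> λ m≤n → child-fresh (occurs-mono m≤n o)

  same-step : ∀ {n m a b} → step n ≡ just a → step m ≡ just b → ¬ n < m → ¬ m < n → a ≡ b
  same-step e₁ e₂ n≮m m≮n with ≤-antisym (≮⇒≥ m≮n) (≮⇒≥ n≮m)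
  ... | refl = just-injective (trans (sym e₁) e₂)

  not-reintroduced-after : ∀ {n m i j k φ ψ} → step n ≡ just (r◇ i φ k) → step m ≡ just (r◇ j ψ k) →
                           ¬ n < m
  not-reintroduced-after e₁ e₂ n<m = child-fresh e₂ (occurs-mono n<m (child-occurs e₁))

  not-reapplied-after : ∀ {n m i j k φ} → step n ≡ just (r◇ i φ j) → step m ≡ just (r◇ i φ k) →
                        ¬ n < m
  not-reapplied-after e₁ e₂ n<m = ◇-unused e₂ (_ , history-mono n<m (step∈history e₁))

  unique-parent : ∀ i j k → i ≺ k → j ≺ k → i ≡ j
  unique-parent i j k (n , φ , e₁) (m , ψ , e₂)
    with same-step e₁ e₂ (not-reintroduced-after e₁ e₂) (not-reintroduced-after e₂ e₁)
  ... | refl = refl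

  acc-if-occurs : ∀ {n j} → Acc _<_ n → OccursOn root (H n) j → Acc _≺_ j
  acc-if-occurs (acc rs) o =
    acc λ { (m , φ , eq) → acc-if-occurs (rs (introduced-before eq o)) (parent-occurs eq) }

  ≺-wellFounded : WellFounded _≺_
  ≺-wellFounded j = acc λ { (m , φ , eq) → acc-if-occurs (<-wellFounded m) (parent-occurs eq) }

  ∈NomΘ : ∀ n {x i} → x ∈ Forms root (H n) → OccursSF i x → NomΘ Θ i
  ∈NomΘ n x∈ o = _ , (n , x∈) , o

  ≺-edges : ∀ i j → i ≺ j → NomΘ Θ i × NomΘ Θ j
  ≺-edges i j (n , φ , eq) =
    ∈NomΘ n (◇-premise eq) (inj₁ refl) , ∈NomΘ (suc n) (child-formula eq) (inj₁ refl)

  root-nominals-are-roots : All (λ r → NomΘ Θ r × ¬ (∃[ p ] (p ≺ r))) (nominalsSF root)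
  root-nominals-are-roots = All.tabulate λ r∈ →
    ∈NomΘ 0 (here refl) (∈nominalsSF⇒OccursSF root r∈) ,
    λ { (p , n , φ , eq) → child-fresh eq (root , here refl , ∈nominalsSF⇒OccursSF root r∈) }

  reachable-from-root : ∀ n {j} → OccursOn root (H n) j → ∃[ r ] (r ∈ nominalsSF root × Star _≺_ r j)
  reachable-from-root zero {j} (x , here refl , o) = j , OccursSF⇒∈nominalsSF root o , ε
  reachable-from-root (suc n) (x , x∈ , o) with new-formula {n} x∈
  ... | inj₁ old = reachable-from-root n (x , old , o)
  ... | inj₂ (a , eq , x∈a) with All.lookup (conclusions-nominals a (applicable eq)) x∈a o
  ...   | inj₁ occ = reachable-from-root n occ
  ...   | inj₂ (i , φ , refl) with reachable-from-root n (parent-occurs eq)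
  ...     | r , r∈ , r⇝i = r , r∈ , r⇝i ◅◅ (n , φ , eq) ◅ ε

  finitely-branching : ∀ i → ∃[ b ] (∀ (L : List Nom) → Unique L → All (i ≺_) L → length L ≤ b)
  finitely-branching i =
    length (subformulas (proj₂ root)) , λ L L! i≺L → injective⇒length≤ one-child L! (All.map label i≺L)
    where
    Child : Nom → Form → Set
    Child j φ = ∃[ n ] (step n ≡ just (r◇ i φ j))

    label : ∀ {j} → i ≺ j → ∃[ φ ] (φ ∈ subformulas (proj₂ root) × Child j φ)
    label (n , φ , eq) = φ , ⊑⇒∈subformulas (⊑-dia⁻ (◇-premise-sub eq)) , n , eq

    one-child : ∀ {j k φ} → Child j φ → Child k φ → j ≡ k
    one-child (n , e₁) (m , e₂)
      with same-step e₁ e₂ (not-reapplied-after e₁ e₂) (not-reapplied-after e₂ e₁)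
    ... | refl = refl

lemma3 : (Θ : Branch) → FiniteForestWFFB (NomΘ Θ) (PrecΘ Θ)
lemma3 Θ = record
  { edges         = ≺-edges Θ
  ; uniqueParent  = unique-parent Θ
  ; wellFounded   = ≺-wellFounded Θ
  ; roots         = nominalsSF (Branch.root Θ)
  ; rootsAreRoots = root-nominals-are-roots Θ
  ; covered       = λ { i (x , (n , x∈) , o) → reachable-from-root Θ n (x , x∈ , o) }
  ; finBranching  = λ i _ → finitely-branching Θ i
  }
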